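{- Let $R=\{(0,0),(0,2),(2,0)\}$. Then $(123,R)\sim_d(132,R)$.
   Context: $S_n$ denotes the set of permutations of $[n]=\{1,\dots,n\}$, written $\pi=\pi_1\cdots\pi_n$. A mesh pattern of length $k$ is a pair $(\tau,R)$ with $\tau\in S_k$ and $R\subseteq\{0,1,\dots,k\}^2$ (the shaded boxes; box $(a,b)$ is the unit square $[a,a+1]\times[b,b+1]$ in the diagram of $\tau$). An occurrence of $(\tau,R)$ in $\pi\in S_n$ is a choice of indices $i_1<\dots<i_k$ such that $\pi_{i_1}\cdots\pi_{i_k}$ is order-isomorphic to $\tau$ and, with $i_0=0$, $i_{k+1}=n+1$, $v_1<\dots<v_k$ the values $\pi_{i_1},\dots,\pi_{i_k}$ sorted increasingly, $v_0=0$, $v_{k+1}=n+1$, for every $(a,b)\in R$ there is no index $m$ with $i_a<m<i_{a+1}$ and $v_b<\pi_m<v_{b+1}$. Mesh patterns $p,q$ are equidistributed, $p\sim_d q$, if for all $n,\ell\ge0$ the number of $\pi\in S_n$ with exactly $\ell$ occurrences of $p$ equals the number with exactly $\ell$ occurrences of $q$. -}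

module Defs where

-- Conventions: a permutation π ∈ S_n is the word π₁⋯πₙ, a List ℕ of length n
-- containing each of 1,…,n exactly once; positions and values are 1-based.

open import Data.Nat using (ℕ; zero; suc; _+_; _<ᵇ_; _≡ᵇ_)
open import Data.Bool using (Bool; true; false; _∧_; _∨_; not; if_then_else_)
open import Data.List using (List; []; _∷_; _++_; map; concatMap; filter; length; upTo; zip; foldr)
open import Data.Bool.ListAction using (all; any)
open import Data.Product using (_×_; _,_; proj₁; proj₂)
open import Relation.Binary.PropositionalEquality using (_≡_)
open import Relation.Nullary.Decidable using (Dec; yes; no)
open import Data.Bool using (T)
open import Data.Bool.Properties using (T?)

range1 : ℕ → List ℕ
range1 n = map suc (upTo n)

-- 1-based lookup (0 if out of range)
at : List ℕ → ℕ → ℕ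
at []       _             = 0
at (x ∷ xs) zero          = 0
at (x ∷ xs) (suc zero)    = x
at (x ∷ xs) (suc (suc m)) = at xs (suc m)

_∈ᵇ_ : ℕ → List ℕ → Bool
x ∈ᵇ xs = any (λ y → x ≡ᵇ y) xs

distinct : List ℕ → Bool
distinct []       = true
distinct (x ∷ xs) = not (x ∈ᵇ xs) ∧ distinct xs

words : ℕ → ℕ → List (List ℕ)
words zero    n = [] ∷ []
words (suc k) n = concatMap (λ x → map (x ∷_) (words k n)) (range1 n)

perms : ℕ → List (List ℕ)
perms n = filter (λ w → T? (distinct w)) (words n n)

choose : ℕ → List ℕ → List (List ℕ)
choose zero    _        = [] ∷ []
choose (suc k) []       = []
choose (suc k) (x ∷ xs) = map (x ∷_) (choose k xs) ++ choose (suc k) xs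

insert : ℕ → List ℕ → List ℕ
insert x []       = x ∷ []
insert x (y ∷ ys) = if x <ᵇ y then x ∷ y ∷ ys else y ∷ insert x ys

sort : List ℕ → List ℕ
sort = foldr insert []

record MeshPattern : Set where
  constructor mesh
  field
    τ : List ℕ
    R : List (ℕ × ℕ)
open MeshPattern public

orderIso : List ℕ → List ℕ → Bool
orderIso xs ys =
  all (λ p → all (λ q → (proj₁ p <ᵇ proj₁ q) ≡ᵇᵇ (proj₂ p <ᵇ proj₂ q)) ps) ps
  where
    ps = zip xs ys
    _≡ᵇᵇ_ : Bool → Bool → Bool
    true  ≡ᵇᵇ b = b
    false ≡ᵇᵇ b = not b

-- Is the index list is = i₁ < ⋯ < i_k an occurrence of p in π (of length n)?
-- With i₀ = 0, i_{k+1} = n+1, v₀ = 0, v_{k+1} = n+1, v₁<⋯<v_k the sorted values.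
isOccurrence : MeshPattern → List ℕ → List ℕ → Bool
isOccurrence p π is =
  orderIso vals (τ p) ∧ all boxEmpty (R p)
  where
    n    = length π
    vals = map (at π) is
    I    = 0 ∷ (is ++ (suc n ∷ []))
    V    = 0 ∷ (sort vals ++ (suc n ∷ []))
    -- 0-based lookup into the extended lists
    ix : List ℕ → ℕ → ℕ
    ix xs a = at xs (suc a)
    boxEmpty : ℕ × ℕ → Bool
    boxEmpty (a , b) =
      not (any (λ m → ((ix I a <ᵇ m) ∧ (m <ᵇ ix I (suc a)))
                    ∧ ((ix V b <ᵇ at π m) ∧ (at π m <ᵇ ix V (suc b))))
               (range1 n))

occurrences : MeshPattern → List ℕ → ℕ
occurrences p π =
  length (filter (λ is → T? (isOccurrence p π is)) (choose (length (τ p)) (range1 (length π))))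

countWith : MeshPattern → ℕ → ℕ → ℕ
countWith p n ℓ = length (filter (λ π → T? (occurrences p π ≡ᵇ ℓ)) (perms n))

Equidistributed : MeshPattern → MeshPattern → Set
Equidistributed p q = ∀ (n ℓ : ℕ) → countWith p n ℓ ≡ countWith q n ℓ

{-# OPTIONS --safe #-}
-- Call a position of π a block start if its entry is a left-to-right minimum; a block
-- runs from one block start to the next.  The map φ reverses, inside every block, the
-- entries following its start.  It is an involution on S_n fixing the block starts, so
-- the entries to the left of a block start are only permuted among themselves.
--
-- In an occurrence (i, j, k) of (123, R) or (132, R), box (0,0) makes π i a left-to-right
-- minimum, and box (2,0) together with π k > π i keeps every later left-to-right minimum
-- (all of which lie below π i) out of (j, k]; so j and k share a block starting at or
-- after i.  Mirroring that block as ρ sends (i, j, k) to positions (i, ρ k, ρ j) of φ π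
-- carrying the values π i, π k, π j, and the set of values left of i, hence box (0,2),
-- is unchanged.  This is a bijection between the occurrences of (123, R) in π and those
-- of (132, R) in φ π.
module Submission where

open import Defs
open import Data.List using (List; []; _∷_)
open import Data.Product using (_,_)

open import Data.Bool using (Bool; true; false; _∧_; not; T; if_then_else_)
open import Data.Bool.Properties using (T?; T-≡; T-∧; T-not-≡)
open import Data.Bool.ListAction using (any; all)
open import Data.Empty using (⊥; ⊥-elim)
open import Data.List using (_++_; map; length; filter; concatMap; upTo; applyUpTo)
open import Data.List.Properties using (length-++; length-map; length-upTo; ∷-injectiveʳ; map-applyUpTo)
open import Data.List.Membership.Propositional using (_∈_; find; lose)
open import Data.List.Membership.Propositional.Properties
  using (∈-filter⁺; ∈-filter⁻; ∈-map⁺; ∈-map⁻; ∈-++⁺ˡ; ∈-++⁺ʳ; ∈-++⁻; ∈-∃++; ∈-upTo⁺; ∈-upTo⁻)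
open import Data.List.Relation.Unary.All using (All; []; _∷_)
import Data.List.Relation.Unary.All as All
open import Data.List.Relation.Unary.All.Properties using (all⁺; all⁻; ¬All⇒Any¬)
open import Data.List.Relation.Unary.Any using (here; there)
import Data.List.Relation.Unary.Any as Any
open import Data.List.Relation.Unary.Any.Properties using (any⁺; any⁻)
open import Data.List.Relation.Unary.AllPairs using ([]; _∷_)
open import Data.List.Relation.Unary.Unique.Propositional using (Unique)
import Data.List.Relation.Unary.Unique.Propositional.Properties as Unique
open import Data.Nat using (ℕ; zero; suc; _+_; _∸_; _≤_; _<_; z≤n; s≤s; z<s; _<ᵇ_; _≡ᵇ_; pred)
open import Data.Nat.Properties
open import Data.Product using (_×_; proj₁; proj₂; ∃-syntax)
open import Data.Sum using (_⊎_; inj₁; inj₂)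
open import Function using (_∘_; id; case_of_)
open import Function.Bundles using (Equivalence)
open import Relation.Binary.Definitions using (tri<; tri≈; tri>)
open import Relation.Binary.PropositionalEquality
open import Relation.Nullary using (¬_)
import Relation.Unary as U

open Equivalence using (to; from)

true-or-false : ∀ b → b ≡ true ⊎ b ≡ false
true-or-false true  = inj₁ refl
true-or-false false = inj₂ refl

≡true⇒≢false : ∀ {b} → b ≡ true → b ≢ false
≡true⇒≢false refl ()

T-not⇒¬T : ∀ {b} → T (not b) → ¬ T b
T-not⇒¬T h = subst T (to T-not-≡ h)

¬T⇒T-not : ∀ {b} → ¬ T b → T (not b)
¬T⇒T-not {true}  ¬b = ¬b _
¬T⇒T-not {false} _  = _

<ᵇ≡true : ∀ {a b} → a < b → (a <ᵇ b) ≡ true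
<ᵇ≡true = to T-≡ ∘ <⇒<ᵇ

<ᵇ≡false : ∀ {a b} → ¬ a < b → (a <ᵇ b) ≡ false
<ᵇ≡false {a} {b} a≮b with a <ᵇ b in eq
... | true  = ⊥-elim (a≮b (<ᵇ⇒< a b (from T-≡ eq)))
... | false = refl

∈-range1⁻ : ∀ {n x} → x ∈ range1 n → 1 ≤ x × x ≤ n
∈-range1⁻ p with ∈-map⁻ suc p
... | _ , i∈ , refl = s≤s z≤n , ∈-upTo⁻ i∈

∈-range1⁺ : ∀ {n x} → 1 ≤ x → x ≤ n → x ∈ range1 n
∈-range1⁺ {x = suc x} _ x≤n = ∈-map⁺ suc (∈-upTo⁺ x≤n)

range1-unique : ∀ n → Unique (range1 n)
range1-unique n = Unique.map⁺ suc-injective (Unique.upTo⁺ n)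

upFrom : ℕ → ℕ → List ℕ
upFrom a zero    = []
upFrom a (suc k) = a ∷ upFrom (suc a) k

applyUpTo≡upFrom : ∀ a k (f : ℕ → ℕ) → (∀ i → f i ≡ a + i) → applyUpTo f k ≡ upFrom a k
applyUpTo≡upFrom a zero    f f≗a+ = refl
applyUpTo≡upFrom a (suc k) f f≗a+ = cong₂ _∷_ (trans (f≗a+ 0) (+-identityʳ a))
  (applyUpTo≡upFrom (suc a) k (f ∘ suc) (λ i → trans (f≗a+ (suc i)) (+-suc a i)))

range1≡upFrom1 : ∀ n → range1 n ≡ upFrom 1 n
range1≡upFrom1 n = trans (map-applyUpTo id suc n) (applyUpTo≡upFrom 1 n suc (λ _ → refl))

length-range1 : ∀ n → length (range1 n) ≡ n
length-range1 n = trans (length-map suc (upTo n)) (length-upTo n)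

at-upFrom : ∀ a k m → m < k → at (upFrom a k) (suc m) ≡ a + m
at-upFrom a (suc k) zero    _         = sym (+-identityʳ a)
at-upFrom a (suc k) (suc m) (s≤s m<k) = trans (at-upFrom (suc a) k m m<k) (sym (+-suc a m))

at-range1 : ∀ n m → 1 ≤ m → m ≤ n → at (range1 n) m ≡ m
at-range1 n (suc m) _ m<n = trans (cong (λ xs → at xs (suc m)) (range1≡upFrom1 n)) (at-upFrom 1 n m m<n)

at-map : ∀ (g : ℕ → ℕ) xs m → 1 ≤ m → m ≤ length xs → at (map g xs) m ≡ g (at xs m)
at-map g (x ∷ xs) 1             _ _         = refl
at-map g (x ∷ xs) (suc (suc m)) _ (s≤s m≤) = at-map g xs (suc m) (s≤s z≤n) m≤

at-∈ : ∀ (xs : List ℕ) m → 1 ≤ m → m ≤ length xs → at xs m ∈ xs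
at-∈ (x ∷ xs) 1             _ _         = here refl
at-∈ (x ∷ xs) (suc (suc m)) _ (s≤s m≤) = there (at-∈ xs (suc m) (s≤s z≤n) m≤)

∈⇒at : ∀ {x} (xs : List ℕ) → x ∈ xs → ∃[ m ] (1 ≤ m × m ≤ length xs × at xs m ≡ x)
∈⇒at (y ∷ xs) (here refl) = 1 , s≤s z≤n , s≤s z≤n , refl
∈⇒at (y ∷ xs) (there p) with ∈⇒at xs p
... | suc m , _ , m≤ , eq = suc (suc m) , s≤s z≤n , s≤s m≤ , eq

at-extensionality : ∀ (xs ys : List ℕ) → length xs ≡ length ys →
  (∀ m → 1 ≤ m → m ≤ length xs → at xs m ≡ at ys m) → xs ≡ ys
at-extensionality []       []       _   _  = refl
at-extensionality (x ∷ xs) (y ∷ ys) len eq = cong₂ _∷_ (eq 1 (s≤s z≤n) (s≤s z≤n))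
  (at-extensionality xs ys (suc-injective len)
    (λ { (suc m) _ m≤ → eq (suc (suc m)) (s≤s z≤n) (s≤s m≤) }))

-- Counting by injections

∈-++-skip : ∀ {B : Set} {v w : B} (ys₁ ys₂ : List B) → v ∈ ys₁ ++ (w ∷ ys₂) → v ≢ w → v ∈ ys₁ ++ ys₂
∈-++-skip []        ys₂ (here refl) v≢w = ⊥-elim (v≢w refl)
∈-++-skip []        ys₂ (there p)   v≢w = p
∈-++-skip (y ∷ ys₁) ys₂ (here refl) v≢w = here refl
∈-++-skip (y ∷ ys₁) ys₂ (there p)   v≢w = there (∈-++-skip ys₁ ys₂ p v≢w)

length-≤-injection : ∀ {A B : Set} (f : A → B) (xs : List A) (ys : List B) → Unique xs →
  (∀ {x} → x ∈ xs → f x ∈ ys) → (∀ {x y} → x ∈ xs → y ∈ xs → f x ≡ f y → x ≡ y) →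
  length xs ≤ length ys
length-≤-injection f []       ys _          _    _   = z≤n
length-≤-injection f (x ∷ xs) ys (x∉ ∷ xs!) into inj with ∈-∃++ (into (here refl))
... | ys₁ , ys₂ , refl = begin
  suc (length xs)               ≤⟨ s≤s (length-≤-injection f xs (ys₁ ++ ys₂) xs! into′ (λ p q → inj (there p) (there q))) ⟩
  suc (length (ys₁ ++ ys₂))     ≡⟨ cong suc (length-++ ys₁) ⟩
  suc (length ys₁ + length ys₂) ≡⟨ +-suc (length ys₁) (length ys₂) ⟨
  length ys₁ + length (f x ∷ ys₂) ≡⟨ length-++ ys₁ ⟨
  length (ys₁ ++ f x ∷ ys₂)     ∎
  where
  open ≤-Reasoning
  into′ : ∀ {y} → y ∈ xs → f y ∈ ys₁ ++ ys₂
  into′ p = ∈-++-skip ys₁ ys₂ (into (there p)) (λ eq → All.lookup x∉ p (inj (here refl) (there p) (sym eq)))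

length-≡-inverses : ∀ {A B : Set} (f : A → B) (g : B → A) (xs : List A) (ys : List B) →
  Unique xs → Unique ys → (∀ {x} → x ∈ xs → f x ∈ ys) → (∀ {y} → y ∈ ys → g y ∈ xs) →
  (∀ {x} → x ∈ xs → g (f x) ≡ x) → (∀ {y} → y ∈ ys → f (g y) ≡ y) →
  length xs ≡ length ys
length-≡-inverses f g xs ys xs! ys! f-into g-into gf fg = ≤-antisym
  (length-≤-injection f xs ys xs! f-into (λ p q eq → trans (sym (gf p)) (trans (cong g eq) (gf q))))
  (length-≤-injection g ys xs ys! g-into (λ p q eq → trans (sym (fg p)) (trans (cong f eq) (fg q))))

length-filter-involution : ∀ {A : Set} {P Q : A → Set} (P? : U.Decidable P) (Q? : U.Decidable Q)
  (f : A → A) (xs : List A) → Unique xs →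
  (∀ {x} → x ∈ xs → f x ∈ xs) → (∀ {x} → x ∈ xs → f (f x) ≡ x) →
  (∀ {x} → x ∈ xs → P x → Q (f x)) → (∀ {x} → x ∈ xs → Q x → P (f x)) →
  length (filter P? xs) ≡ length (filter Q? xs)
length-filter-involution P? Q? f xs xs! f-into ff P⇒Qf Q⇒Pf = length-≡-inverses f f
  (filter P? xs) (filter Q? xs) (Unique.filter⁺ P? xs!) (Unique.filter⁺ Q? xs!)
  (λ p → let x∈ , Px = ∈-filter⁻ P? p in ∈-filter⁺ Q? (f-into x∈) (P⇒Qf x∈ Px))
  (λ p → let x∈ , Qx = ∈-filter⁻ Q? p in ∈-filter⁺ P? (f-into x∈) (Q⇒Pf x∈ Qx))
  (ff ∘ proj₁ ∘ ∈-filter⁻ P?)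
  (ff ∘ proj₁ ∘ ∈-filter⁻ Q?)

data Ascending : ℕ → List ℕ → Set where
  []  : ∀ {a} → Ascending a []
  _∷_ : ∀ {a x t} → a ≤ x → Ascending (suc x) t → Ascending a (x ∷ t)

Ascending-weaken : ∀ {a b t} → a ≤ b → Ascending b t → Ascending a t
Ascending-weaken a≤b []         = []
Ascending-weaken a≤b (b≤x ∷ xs) = ≤-trans a≤b b≤x ∷ xs

All-<-+-suc : ∀ {a k t} → All (_< suc a + k) t → All (_< a + suc k) t
All-<-+-suc {a} {k} = All.map (λ {y} y< → subst (y <_) (sym (+-suc a k)) y<)

All-<-+-suc⁻ : ∀ {a k t} → All (_< a + suc k) t → All (_< suc a + k) t
All-<-+-suc⁻ {a} {k} = All.map (λ {y} y< → subst (y <_) (+-suc a k) y<)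

∈-choose-upFrom⁻ : ∀ c a k {t} → t ∈ choose c (upFrom a k) →
  length t ≡ c × Ascending a t × All (_< a + k) t
∈-choose-upFrom⁻ zero    a k       (here refl) = refl , [] , []
∈-choose-upFrom⁻ (suc c) a (suc k) p with ∈-++⁻ (map (a ∷_) (choose c (upFrom (suc a) k))) p
... | inj₁ q with ∈-map⁻ (a ∷_) q
...   | _ , q′ , refl with ∈-choose-upFrom⁻ c (suc a) k q′
...     | len , asc , bnd = cong suc len , ≤-refl ∷ asc , m<m+n a z<s ∷ All-<-+-suc bnd
∈-choose-upFrom⁻ (suc c) a (suc k) p | inj₂ q with ∈-choose-upFrom⁻ (suc c) (suc a) k q
... | len , asc , bnd = len , Ascending-weaken (n≤1+n a) asc , All-<-+-suc bnd

∈-choose-upFrom⁺ : ∀ c a k t → length t ≡ c → Ascending a t → All (_< a + k) t → t ∈ choose c (upFrom a k)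
∈-choose-upFrom⁺ zero    a k       []      _   _           _          = here refl
∈-choose-upFrom⁺ (suc c) a zero    (x ∷ t) _   (a≤x ∷ _)   (x< ∷ _)   =
  ⊥-elim (<⇒≱ (subst (x <_) (+-identityʳ a) x<) a≤x)
∈-choose-upFrom⁺ (suc c) a (suc k) (x ∷ t) len (a≤x ∷ asc) (x< ∷ bnd) with m≤n⇒m<n∨m≡n a≤x
... | inj₂ refl = ∈-++⁺ˡ (∈-map⁺ (a ∷_)
  (∈-choose-upFrom⁺ c (suc a) k t (suc-injective len) asc (All-<-+-suc⁻ bnd)))
... | inj₁ a<x  = ∈-++⁺ʳ (map (a ∷_) (choose c (upFrom (suc a) k)))
  (∈-choose-upFrom⁺ (suc c) (suc a) k (x ∷ t) len (a<x ∷ asc) (All-<-+-suc⁻ (x< ∷ bnd)))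

choose-upFrom-unique : ∀ c a k → Unique (choose c (upFrom a k))
choose-upFrom-unique zero    a k       = [] ∷ []
choose-upFrom-unique (suc c) a zero    = []
choose-upFrom-unique (suc c) a (suc k) =
  Unique.++⁺ (Unique.map⁺ ∷-injectiveʳ (choose-upFrom-unique c (suc a) k))
             (choose-upFrom-unique (suc c) (suc a) k) disjoint
  where
  disjoint : ∀ {v} → ¬ (v ∈ map (a ∷_) (choose c (upFrom (suc a) k)) × v ∈ choose (suc c) (upFrom (suc a) k))
  disjoint (p , q) with ∈-map⁻ (a ∷_) p
  ... | _ , _ , refl with ∈-choose-upFrom⁻ (suc c) (suc a) k q
  ...   | _ , sa≤a ∷ _ , _ = <-irrefl refl sa≤a

Triples : ℕ → List (List ℕ)
Triples n = choose 3 (range1 n)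

∈-Triples⁻ : ∀ n {t} → t ∈ Triples n → ∃[ i ] ∃[ j ] ∃[ k ] (t ≡ i ∷ j ∷ k ∷ [] × 1 ≤ i × i < j × j < k × k ≤ n)
∈-Triples⁻ n {t} p with ∈-choose-upFrom⁻ 3 1 n (subst (λ r → t ∈ choose 3 r) (range1≡upFrom1 n) p)
... | _ , 1≤i ∷ i<j ∷ j<k ∷ [] , _ ∷ _ ∷ s≤s k≤n ∷ [] = _ , _ , _ , refl , 1≤i , i<j , j<k , k≤n

∈-Triples⁺ : ∀ n {i j k} → 1 ≤ i → i < j → j < k → k ≤ n → (i ∷ j ∷ k ∷ []) ∈ Triples n
∈-Triples⁺ n {i} {j} {k} 1≤i i<j j<k k≤n =
  subst (λ r → (i ∷ j ∷ k ∷ []) ∈ choose 3 r) (sym (range1≡upFrom1 n))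
    (∈-choose-upFrom⁺ 3 1 n _ refl (1≤i ∷ i<j ∷ j<k ∷ [])
      (s≤s (≤-trans (<⇒≤ (<-trans i<j j<k)) k≤n) ∷ s≤s (≤-trans (<⇒≤ j<k) k≤n) ∷ s≤s k≤n ∷ []))

Triples-unique : ∀ n → Unique (Triples n)
Triples-unique n = subst (λ r → Unique (choose 3 r)) (sym (range1≡upFrom1 n)) (choose-upFrom-unique 3 1 n)

module ConsEach (W : List (List ℕ)) where
  consEach : ℕ → List (List ℕ)
  consEach x = map (x ∷_) W

  ∈-concatMap⁻ : ∀ xs {t} → t ∈ concatMap consEach xs → ∃[ x ] ∃[ t′ ] (t ≡ x ∷ t′ × x ∈ xs × t′ ∈ W)
  ∈-concatMap⁻ (x ∷ xs) p with ∈-++⁻ (consEach x) p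
  ... | inj₁ q with ∈-map⁻ (x ∷_) q
  ...   | t′ , t′∈ , refl = x , t′ , refl , here refl , t′∈
  ∈-concatMap⁻ (x ∷ xs) p | inj₂ q with ∈-concatMap⁻ xs q
  ... | y , t′ , eq , y∈ , t′∈ = y , t′ , eq , there y∈ , t′∈

  ∈-concatMap⁺ : ∀ xs {x t′} → x ∈ xs → t′ ∈ W → (x ∷ t′) ∈ concatMap consEach xs
  ∈-concatMap⁺ (x ∷ xs) (here refl) q = ∈-++⁺ˡ (∈-map⁺ (x ∷_) q)
  ∈-concatMap⁺ (y ∷ xs) (there p)   q = ∈-++⁺ʳ (consEach y) (∈-concatMap⁺ xs p q)

  concatMap-unique : ∀ xs → Unique xs → Unique W → Unique (concatMap consEach xs)
  concatMap-unique []       _          _  = []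
  concatMap-unique (x ∷ xs) (x∉ ∷ xs!) W! =
    Unique.++⁺ (Unique.map⁺ ∷-injectiveʳ W!) (concatMap-unique xs xs! W!) disjoint
    where
    disjoint : ∀ {v} → ¬ (v ∈ consEach x × v ∈ concatMap consEach xs)
    disjoint (p , q) with ∈-map⁻ (x ∷_) p
    ... | _ , _ , refl with ∈-concatMap⁻ xs q
    ...   | _ , _ , refl , x∈ , _ = All.lookup x∉ x∈ refl

EntriesIn : ℕ → List ℕ → Set
EntriesIn n π = ∀ {x} → x ∈ π → 1 ≤ x × x ≤ n

∈-words⁻ : ∀ k n {π} → π ∈ words k n → length π ≡ k × EntriesIn n π
∈-words⁻ zero    n (here refl) = refl , λ ()
∈-words⁻ (suc k) n p with ConsEach.∈-concatMap⁻ (words k n) (range1 n) p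
... | x , π , refl , x∈ , π∈ with ∈-words⁻ k n π∈
...   | len , entries = cong suc len , λ { (here refl) → ∈-range1⁻ x∈ ; (there q) → entries q }

∈-words⁺ : ∀ k n π → length π ≡ k → EntriesIn n π → π ∈ words k n
∈-words⁺ zero    n []      _   _       = here refl
∈-words⁺ (suc k) n (x ∷ π) len entries =
  ConsEach.∈-concatMap⁺ (words k n) (range1 n) (∈-range1⁺ 1≤x x≤n)
    (∈-words⁺ k n π (suc-injective len) (entries ∘ there))
  where
  1≤x : 1 ≤ x
  1≤x = proj₁ (entries (here refl))
  x≤n : x ≤ n
  x≤n = proj₂ (entries (here refl))

words-unique : ∀ k n → Unique (words k n)
words-unique zero    n = [] ∷ []
words-unique (suc k) n = ConsEach.concatMap-unique (words k n) (range1 n) (range1-unique n) (words-unique k n)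

∈ᵇ⇒∈ : ∀ x xs → T (x ∈ᵇ xs) → x ∈ xs
∈ᵇ⇒∈ x xs = Any.map (≡ᵇ⇒≡ x _) ∘ any⁻ _ xs

∈⇒∈ᵇ : ∀ {x xs} → x ∈ xs → T (x ∈ᵇ xs)
∈⇒∈ᵇ {x} = any⁺ _ ∘ Any.map (≡⇒≡ᵇ x _)

AtInjective : List ℕ → Set
AtInjective π = ∀ a b → 1 ≤ a → a ≤ length π → 1 ≤ b → b ≤ length π → at π a ≡ at π b → a ≡ b

distinct⇒AtInjective : ∀ xs → T (distinct xs) → AtInjective xs
distinct⇒AtInjective (x ∷ xs) d 1 1 _ _ _ _ eq = refl
distinct⇒AtInjective (x ∷ xs) d 1 (suc (suc b)) _ _ _ (s≤s b≤) eq =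
  ⊥-elim (T-not⇒¬T (proj₁ (to T-∧ d)) (∈⇒∈ᵇ (subst (_∈ xs) (sym eq) (at-∈ xs (suc b) (s≤s z≤n) b≤))))
distinct⇒AtInjective (x ∷ xs) d (suc (suc a)) 1 _ (s≤s a≤) _ _ eq =
  ⊥-elim (T-not⇒¬T (proj₁ (to T-∧ d)) (∈⇒∈ᵇ (subst (_∈ xs) eq (at-∈ xs (suc a) (s≤s z≤n) a≤))))
distinct⇒AtInjective (x ∷ xs) d (suc (suc a)) (suc (suc b)) _ (s≤s a≤) _ (s≤s b≤) eq =
  cong suc (distinct⇒AtInjective xs (proj₂ (to T-∧ d)) (suc a) (suc b) (s≤s z≤n) a≤ (s≤s z≤n) b≤ eq)

AtInjective⇒distinct : ∀ xs → AtInjective xs → T (distinct xs)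
AtInjective⇒distinct []       _   = _
AtInjective⇒distinct (x ∷ xs) inj = from T-∧ (¬T⇒T-not (x∉xs ∘ ∈ᵇ⇒∈ x xs) , AtInjective⇒distinct xs inj′)
  where
  inj′ : AtInjective xs
  inj′ (suc a) (suc b) _ a≤ _ b≤ eq =
    suc-injective (inj (suc (suc a)) (suc (suc b)) (s≤s z≤n) (s≤s a≤) (s≤s z≤n) (s≤s b≤) eq)
  x∉xs : ¬ x ∈ xs
  x∉xs p with ∈⇒at xs p
  ... | suc m , _ , m≤ , eq with inj 1 (suc (suc m)) (s≤s z≤n) (s≤s z≤n) (s≤s z≤n) (s≤s m≤) (sym eq)
  ... | ()

∈-perms⁻ : ∀ n {π} → π ∈ perms n → length π ≡ n × EntriesIn n π × AtInjective π
∈-perms⁻ n {π} p with ∈-filter⁻ (T? ∘ distinct) p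
... | π∈ , d with ∈-words⁻ n n π∈
...   | len , entries = len , entries , distinct⇒AtInjective π d

∈-perms⁺ : ∀ n π → length π ≡ n → EntriesIn n π → AtInjective π → π ∈ perms n
∈-perms⁺ n π len entries inj = ∈-filter⁺ (T? ∘ distinct) (∈-words⁺ n n π len entries) (AtInjective⇒distinct π inj)

perms-unique : ∀ n → Unique (perms n)
perms-unique n = Unique.filter⁺ (T? ∘ distinct) (words-unique n n)

-- Blocks and their reflection

m+n≡o+p∧o<m⇒n<p : ∀ {m n o p} → m + n ≡ o + p → o < m → n < p
m+n≡o+p∧o<m⇒n<p {m} {n} {o} {p} eq o<m with <-cmp n p
... | tri< n<p _ _ = n<p
... | tri≈ _ refl _ = ⊥-elim (<-irrefl (sym eq) (+-monoˡ-< n o<m))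
... | tri> _ _ p<n = ⊥-elim (<-irrefl (sym eq) (+-mono-< o<m p<n))

lastAtMost : (ℕ → Bool) → ℕ → ℕ
lastAtMost L zero    = zero
lastAtMost L (suc m) = if L (suc m) then suc m else lastAtMost L m

firstAfter : (ℕ → Bool) → ℕ → ℕ → ℕ
firstAfter L m zero    = suc m
firstAfter L m (suc f) = if L (suc m) then suc m else firstAfter L (suc m) f

module Search (L : ℕ → Bool) where

  lastAtMost-≤ : ∀ m → lastAtMost L m ≤ m
  lastAtMost-≤ zero = z≤n
  lastAtMost-≤ (suc m) with L (suc m)
  ... | true  = ≤-refl
  ... | false = m≤n⇒m≤1+n (lastAtMost-≤ m)

  lastAtMost-holds : L 1 ≡ true → ∀ m → 1 ≤ m → 1 ≤ lastAtMost L m × L (lastAtMost L m) ≡ true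
  lastAtMost-holds L1 (suc m) _ with L (suc m) in eq
  ... | true = s≤s z≤n , eq
  lastAtMost-holds L1 1             _ | false with () ← trans (sym L1) eq
  lastAtMost-holds L1 (suc (suc m)) _ | false = lastAtMost-holds L1 (suc m) (s≤s z≤n)

  lastAtMost-last : ∀ m z → lastAtMost L m < z → z ≤ m → L z ≡ false
  lastAtMost-last zero    z s<z z≤m = ⊥-elim (<-irrefl refl (<-≤-trans s<z z≤m))
  lastAtMost-last (suc m) z s<z z≤m with L (suc m) in eq
  ... | true  = ⊥-elim (<-irrefl refl (<-≤-trans s<z z≤m))
  ... | false with m≤n⇒m<n∨m≡n z≤m
  ...   | inj₂ refl       = eq
  ...   | inj₁ (s≤s z≤m′) = lastAtMost-last m z s<z z≤m′

  lastAtMost-unique : ∀ m y → y ≤ m → L y ≡ true → (∀ z → y < z → z ≤ m → L z ≡ false) → lastAtMost L m ≡ y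
  lastAtMost-unique zero    zero _   _  _     = refl
  lastAtMost-unique (suc m) y    y≤m Ly after with m≤n⇒m<n∨m≡n y≤m
  ... | inj₂ refl rewrite Ly = refl
  ... | inj₁ (s≤s y≤m′) rewrite after (suc m) (s≤s y≤m′) ≤-refl =
    lastAtMost-unique m y y≤m′ Ly (λ z y<z z≤m → after z y<z (m≤n⇒m≤1+n z≤m))

  firstAfter-> : ∀ m f → m < firstAfter L m f
  firstAfter-> m zero = ≤-refl
  firstAfter-> m (suc f) with L (suc m)
  ... | true  = ≤-refl
  ... | false = <⇒≤ (firstAfter-> (suc m) f)

  firstAfter-≤ : ∀ m f → firstAfter L m f ≤ suc (m + f)
  firstAfter-≤ m zero = s≤s (≤-reflexive (sym (+-identityʳ m)))
  firstAfter-≤ m (suc f) with L (suc m)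
  ... | true  = s≤s (m≤m+n m (suc f))
  ... | false = subst (λ r → firstAfter L (suc m) f ≤ suc r) (sym (+-suc m f)) (firstAfter-≤ (suc m) f)

  firstAfter-first : ∀ m f z → m < z → z < firstAfter L m f → L z ≡ false
  firstAfter-first m zero z m<z z<e = ⊥-elim (<-irrefl refl (<-≤-trans m<z (m<1+n⇒m≤n z<e)))
  firstAfter-first m (suc f) z m<z z<e with L (suc m) in eq
  ... | true  = ⊥-elim (<-irrefl refl (<-≤-trans m<z (m<1+n⇒m≤n z<e)))
  ... | false with m≤n⇒m<n∨m≡n m<z
  ...   | inj₂ refl = eq
  ...   | inj₁ sm<z = firstAfter-first (suc m) f z sm<z z<e

  firstAfter-holds : ∀ m f → firstAfter L m f ≤ m + f → L (firstAfter L m f) ≡ true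
  firstAfter-holds m zero e≤ = ⊥-elim (<-irrefl refl (≤-trans e≤ (≤-reflexive (+-identityʳ m))))
  firstAfter-holds m (suc f) e≤ with L (suc m) in eq
  ... | true  = eq
  ... | false = firstAfter-holds (suc m) f (subst (firstAfter L (suc m) f ≤_) (+-suc m f) e≤)

  firstAfter-unique : ∀ m f y → m < y → y ≤ m + f → L y ≡ true → (∀ z → m < z → z < y → L z ≡ false) →
    firstAfter L m f ≡ y
  firstAfter-unique m zero y m<y y≤ Ly before =
    ⊥-elim (<-irrefl refl (<-≤-trans m<y (≤-trans y≤ (≤-reflexive (+-identityʳ m)))))
  firstAfter-unique m (suc f) y m<y y≤ Ly before with m≤n⇒m<n∨m≡n m<y
  ... | inj₂ refl rewrite Ly = refl
  ... | inj₁ sm<y rewrite before (suc m) ≤-refl sm<y =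
    firstAfter-unique (suc m) f y sm<y (subst (y ≤_) (+-suc m f) y≤) Ly (λ z sm<z z<y → before z (<⇒≤ sm<z) z<y)

  firstAfter-none : ∀ m f → (∀ z → m < z → z ≤ m + f → L z ≡ false) → firstAfter L m f ≡ suc (m + f)
  firstAfter-none m zero    _    = cong suc (sym (+-identityʳ m))
  firstAfter-none m (suc f) none rewrite none (suc m) ≤-refl (m<m+n m z<s) =
    trans (firstAfter-none (suc m) f (λ z sm<z z≤ → none z (<⇒≤ sm<z) (subst (z ≤_) (sym (+-suc m f)) z≤)))
          (cong suc (sym (+-suc m f)))

  lastAtMost-cong : ∀ L′ m → (∀ x → 1 ≤ x → x ≤ m → L x ≡ L′ x) → lastAtMost L m ≡ lastAtMost L′ m
  lastAtMost-cong L′ zero    _   = refl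
  lastAtMost-cong L′ (suc m) L≗L′ rewrite L≗L′ (suc m) (s≤s z≤n) ≤-refl
    | lastAtMost-cong L′ m (λ x 1≤x x≤m → L≗L′ x 1≤x (m≤n⇒m≤1+n x≤m)) = refl

  firstAfter-cong : ∀ L′ m f → (∀ x → m < x → x ≤ m + f → L x ≡ L′ x) → firstAfter L m f ≡ firstAfter L′ m f
  firstAfter-cong L′ m zero    _    = refl
  firstAfter-cong L′ m (suc f) L≗L′ rewrite L≗L′ (suc m) ≤-refl (m<m+n m z<s)
    | firstAfter-cong L′ (suc m) f (λ x sm<x x≤ → L≗L′ x (<⇒≤ sm<x) (subst (x ≤_) (sym (+-suc m f)) x≤)) = refl

blockEnd : (ℕ → Bool) → ℕ → ℕ → ℕ
blockEnd L n m = firstAfter L m (n ∸ m)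

-- The positions of [1, n] where L holds cut it into blocks [s, e); reflect fixes
-- every block start s and mirrors the rest of its block, m ↦ s + e − m.
reflect : (ℕ → Bool) → ℕ → ℕ → ℕ
reflect L n m = if L m then m else (lastAtMost L m + blockEnd L n m) ∸ m

reflect-cong : ∀ L L′ n m → (∀ x → 1 ≤ x → x ≤ n → L x ≡ L′ x) → 1 ≤ m → m ≤ n → reflect L n m ≡ reflect L′ n m
reflect-cong L L′ n m L≗L′ 1≤m m≤n
  rewrite L≗L′ m 1≤m m≤n
        | Search.lastAtMost-cong L L′ m (λ x 1≤x x≤m → L≗L′ x 1≤x (≤-trans x≤m m≤n))
        | Search.firstAfter-cong L L′ m (n ∸ m)
            (λ x m<x x≤ → L≗L′ x (≤-trans 1≤m (<⇒≤ m<x)) (subst (x ≤_) (m+[n∸m]≡n m≤n) x≤)) = refl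

module Blocks (L : ℕ → Bool) (n : ℕ) (L1 : L 1 ≡ true) where
  open Search L

  ρ : ℕ → ℕ
  ρ = reflect L n

  record Block (s e : ℕ) : Set where
    field
      1≤s    : 1 ≤ s
      e≤1+n  : e ≤ suc n
      L-s    : L s ≡ true
      ¬L-in  : ∀ z → s < z → z < e → L z ≡ false
      L-e    : e ≤ n → L e ≡ true

  blockOf : ∀ m → 1 ≤ m → m ≤ n → L m ≡ false →
    Block (lastAtMost L m) (blockEnd L n m) × lastAtMost L m < m × m < blockEnd L n m
  blockOf m 1≤m m≤n ¬Lm = block , s<m , firstAfter-> m (n ∸ m)
    where
    s : ℕ
    s = lastAtMost L m
    Ls : 1 ≤ s × L s ≡ true
    Ls = lastAtMost-holds L1 m 1≤m
    m+[n∸m] : m + (n ∸ m) ≡ n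
    m+[n∸m] = m+[n∸m]≡n m≤n
    s<m : s < m
    s<m = ≤∧≢⇒< (lastAtMost-≤ m) (λ s≡m → ≡true⇒≢false (trans (cong L (sym s≡m)) (proj₂ Ls)) ¬Lm)
    ¬L-in : ∀ z → s < z → z < blockEnd L n m → L z ≡ false
    ¬L-in z s<z z<e with ≤-<-connex z m
    ... | inj₁ z≤m = lastAtMost-last m z s<z z≤m
    ... | inj₂ m<z = firstAfter-first m (n ∸ m) z m<z z<e
    block : Block s (blockEnd L n m)
    block = record
      { 1≤s   = proj₁ Ls
      ; e≤1+n = subst (λ r → blockEnd L n m ≤ suc r) m+[n∸m] (firstAfter-≤ m (n ∸ m))
      ; L-s   = proj₂ Ls
      ; ¬L-in = ¬L-in
      ; L-e   = λ e≤n → firstAfter-holds m (n ∸ m) (subst (blockEnd L n m ≤_) (sym m+[n∸m]) e≤n) }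

  module _ {s e} (B : Block s e) where
    open Block B

    inBlock : ∀ {x} → s < x → x < e → lastAtMost L x ≡ s × blockEnd L n x ≡ e × L x ≡ false
    inBlock {x} s<x x<e = start , end , ¬L-in x s<x x<e
      where
      x≤n : x ≤ n
      x≤n = m<1+n⇒m≤n (<-≤-trans x<e e≤1+n)
      x+[n∸x] : x + (n ∸ x) ≡ n
      x+[n∸x] = m+[n∸m]≡n x≤n
      start : lastAtMost L x ≡ s
      start = lastAtMost-unique x s (<⇒≤ s<x) L-s (λ z s<z z≤x → ¬L-in z s<z (≤-<-trans z≤x x<e))
      end : blockEnd L n x ≡ e
      end with m≤n⇒m<n∨m≡n e≤1+n
      ... | inj₁ (s≤s e≤n) = firstAfter-unique x (n ∸ x) e x<e (subst (e ≤_) (sym x+[n∸x]) e≤n) (L-e e≤n)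
                               (λ z x<z z<e → ¬L-in z (<-trans s<x x<z) z<e)
      ... | inj₂ refl = trans (firstAfter-none x (n ∸ x)
                                (λ z x<z z≤ → ¬L-in z (<-trans s<x x<z) (s≤s (subst (z ≤_) x+[n∸x] z≤))))
                              (cong suc x+[n∸x])

    reflect-sum : ∀ {x} → s < x → x < e → x + ρ x ≡ s + e
    reflect-sum {x} s<x x<e with inBlock s<x x<e
    ... | start , end , ¬Lx rewrite ¬Lx | start | end = m+[n∸m]≡n (≤-trans (<⇒≤ x<e) (m≤n+m e s))

    reflect-inBlock : ∀ {x} → s < x → x < e → s < ρ x × ρ x < e
    reflect-inBlock {x} s<x x<e =
      m+n≡o+p∧o<m⇒n<p (trans (+-comm e s) (sym (reflect-sum s<x x<e))) x<e ,
      m+n≡o+p∧o<m⇒n<p (reflect-sum s<x x<e) s<x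

    reflect-antitone : ∀ {x y} → s < x → x < y → y < e → ρ y < ρ x
    reflect-antitone s<x x<y y<e =
      m+n≡o+p∧o<m⇒n<p (trans (reflect-sum (<-trans s<x x<y) y<e) (sym (reflect-sum s<x (<-trans x<y y<e)))) x<y

    reflect-inBlock-involutive : ∀ {x} → s < x → x < e → ρ (ρ x) ≡ x
    reflect-inBlock-involutive {x} s<x x<e = +-cancelˡ-≡ (ρ x) _ _
      (trans (reflect-sum s<ρx ρx<e) (trans (sym (reflect-sum s<x x<e)) (+-comm x (ρ x))))
      where
      s<ρx : s < ρ x
      s<ρx = proj₁ (reflect-inBlock s<x x<e)
      ρx<e : ρ x < e
      ρx<e = proj₂ (reflect-inBlock s<x x<e)

  reflect-fixed : ∀ {m} → L m ≡ true → ρ m ≡ m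
  reflect-fixed Lm rewrite Lm = refl

  reflect-range : ∀ m → 1 ≤ m → m ≤ n → 1 ≤ ρ m × ρ m ≤ n
  reflect-range m 1≤m m≤n with true-or-false (L m)
  ... | inj₁ Lm rewrite reflect-fixed Lm = 1≤m , m≤n
  ... | inj₂ ¬Lm with blockOf m 1≤m m≤n ¬Lm
  ...   | B , s<m , m<e with reflect-inBlock B s<m m<e
  ...     | s<ρm , ρm<e = ≤-trans (Block.1≤s B) (<⇒≤ s<ρm) , m<1+n⇒m≤n (<-≤-trans ρm<e (Block.e≤1+n B))

  reflect-involutive : ∀ m → 1 ≤ m → m ≤ n → ρ (ρ m) ≡ m
  reflect-involutive m 1≤m m≤n with true-or-false (L m)
  ... | inj₁ Lm rewrite reflect-fixed Lm = reflect-fixed Lm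
  ... | inj₂ ¬Lm with blockOf m 1≤m m≤n ¬Lm
  ...   | B , s<m , m<e = reflect-inBlock-involutive B s<m m<e

  reflect-below : ∀ {i m} → L i ≡ true → i ≤ n → 1 ≤ m → m < i → 1 ≤ ρ m × ρ m < i
  reflect-below {i} {m} Li i≤n 1≤m m<i with true-or-false (L m)
  ... | inj₁ Lm rewrite reflect-fixed Lm = 1≤m , m<i
  ... | inj₂ ¬Lm with blockOf m 1≤m (≤-trans (<⇒≤ m<i) i≤n) ¬Lm
  ...   | B , s<m , m<e with reflect-inBlock B s<m m<e
  ...     | s<ρm , ρm<e = ≤-trans (Block.1≤s B) (<⇒≤ s<ρm) , <-≤-trans ρm<e e≤i
    where
    e≤i : blockEnd L n m ≤ i
    e≤i = ≮⇒≥ (λ i<e → ≡true⇒≢false Li (Block.¬L-in B i (<-trans s<m m<i) i<e))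

-- Left-to-right minima and the involution φ

isLRMin : List ℕ → ℕ → Bool
isLRMin σ m = all (λ y → at σ m <ᵇ at σ y) (range1 (pred m))

module _ (σ : List ℕ) where

  private
    ≤pred⇒< : ∀ {y m} → 1 ≤ y → y ≤ pred m → y < m
    ≤pred⇒< {m = suc m} _ y≤m = s≤s y≤m
    ≤pred⇒< {m = zero}  1≤y y≤0 = ⊥-elim (<⇒≱ 1≤y y≤0)

  isLRMin-sound : ∀ {i} → isLRMin σ i ≡ true → ∀ m → 1 ≤ m → m < i → at σ i < at σ m
  isLRMin-sound {i} Li m 1≤m m<i =
    <ᵇ⇒< _ _ (All.lookup (all⁺ _ (range1 (pred i)) (from T-≡ Li)) (∈-range1⁺ 1≤m (<⇒≤pred m<i)))

  isLRMin-complete : ∀ {i} → (∀ m → 1 ≤ m → m < i → at σ i < at σ m) → isLRMin σ i ≡ true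
  isLRMin-complete {i} below = to T-≡ (all⁻ _ (All.tabulate λ {m} m∈ →
    let 1≤m , m≤ = ∈-range1⁻ m∈ in <⇒<ᵇ (below m 1≤m (≤pred⇒< 1≤m m≤))))

  isLRMin-witness : ∀ {z} → isLRMin σ z ≡ false → ∃[ y ] (1 ≤ y × y < z × at σ y ≤ at σ z)
  isLRMin-witness {z} ¬Lz with find (¬All⇒Any¬ (T? ∘ _) (range1 (pred z)) (λ all → ≡true⇒≢false (to T-≡ (all⁻ _ all)) ¬Lz))
  ... | y , y∈ , σz≮σy = let 1≤y , y≤ = ∈-range1⁻ y∈ in y , 1≤y , ≤pred⇒< 1≤y y≤ , ≮⇒≥ (σz≮σy ∘ <⇒<ᵇ)

  isLRMin-false : ∀ {i z} → 1 ≤ i → i < z → at σ i < at σ z → isLRMin σ z ≡ false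
  isLRMin-false {i} {z} 1≤i i<z σi<σz with true-or-false (isLRMin σ z)
  ... | inj₁ Lz = ⊥-elim (<-asym σi<σz (isLRMin-sound Lz i 1≤i i<z))
  ... | inj₂ ¬Lz = ¬Lz

lrReflect : List ℕ → ℕ → ℕ
lrReflect σ = reflect (isLRMin σ) (length σ)

φ : List ℕ → List ℕ
φ σ = map (λ m → at σ (lrReflect σ m)) (range1 (length σ))

length-φ : ∀ σ → length (φ σ) ≡ length σ
length-φ σ = trans (length-map _ (range1 (length σ))) (length-range1 (length σ))

at-φ : ∀ σ m → 1 ≤ m → m ≤ length σ → at (φ σ) m ≡ at σ (lrReflect σ m)
at-φ σ m 1≤m m≤n = trans
  (at-map _ (range1 (length σ)) m 1≤m (subst (m ≤_) (sym (length-range1 (length σ))) m≤n))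
  (cong (at σ ∘ lrReflect σ) (at-range1 (length σ) m 1≤m m≤n))

record DistinctPositive (σ : List ℕ) : Set where
  field
    positive  : ∀ m → 1 ≤ m → m ≤ length σ → 1 ≤ at σ m
    injective : AtInjective σ

module Involution (σ : List ℕ) (D : DistinctPositive σ) where
  open DistinctPositive D
  n : ℕ
  n = length σ
  open Blocks (isLRMin σ) n refl public

  blockStart-prefixMin : ∀ {s e} → Block s e → ∀ x → s ≤ x → x < e → ∀ y → 1 ≤ y → y ≤ x → at σ s ≤ at σ y
  blockStart-prefixMin B zero    s≤0 _ _ 1≤y y≤0 = ⊥-elim (<⇒≱ (Block.1≤s B) s≤0)
  blockStart-prefixMin B (suc x) s≤x x<e y 1≤y y≤x with m≤n⇒m<n∨m≡n s≤x | m≤n⇒m<n∨m≡n y≤x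
  ... | inj₂ refl  | inj₂ refl     = ≤-refl
  ... | inj₂ refl  | inj₁ y<s      = <⇒≤ (isLRMin-sound σ (Block.L-s B) y 1≤y y<s)
  ... | inj₁ s<1+x | inj₁ (s≤s y≤x′) = blockStart-prefixMin B x (≤-pred s<1+x) (<-trans ≤-refl x<e) y 1≤y y≤x′
  ... | inj₁ s<1+x | inj₂ refl with isLRMin-witness σ (Block.¬L-in B (suc x) s<1+x x<e)
  ...   | y′ , 1≤y′ , y′<y , σy′≤σy =
    ≤-trans (blockStart-prefixMin B x (≤-pred s<1+x) (<-trans ≤-refl x<e) y′ 1≤y′ (≤-pred y′<y)) σy′≤σy

  blockStart-below : ∀ {s e x} → Block s e → s < x → x < e → at σ s < at σ x
  blockStart-below {s} {e} {x} B s<x x<e = ≤∧≢⇒<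
    (blockStart-prefixMin B x (<⇒≤ s<x) x<e x 1≤x ≤-refl)
    (λ σs≡σx → <-irrefl (injective s x (Block.1≤s B) (≤-trans (<⇒≤ s<x) x≤n) 1≤x x≤n σs≡σx) s<x)
    where
    1≤x : 1 ≤ x
    1≤x = ≤-trans (Block.1≤s B) (<⇒≤ s<x)
    x≤n : x ≤ n
    x≤n = m<1+n⇒m≤n (<-≤-trans x<e (Block.e≤1+n B))

  φ-at-reflect : ∀ m → 1 ≤ m → m ≤ n → at (φ σ) (ρ m) ≡ at σ m
  φ-at-reflect m 1≤m m≤n = let 1≤ρm , ρm≤n = reflect-range m 1≤m m≤n in
    trans (at-φ σ (ρ m) 1≤ρm ρm≤n) (cong (at σ) (reflect-involutive m 1≤m m≤n))

  φ-at-lrMin : ∀ {m} → isLRMin σ m ≡ true → 1 ≤ m → m ≤ n → at (φ σ) m ≡ at σ m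
  φ-at-lrMin {m} Lm 1≤m m≤n = trans (at-φ σ m 1≤m m≤n) (cong (at σ) (reflect-fixed Lm))

  isLRMin-φ : ∀ m → 1 ≤ m → m ≤ n → isLRMin (φ σ) m ≡ isLRMin σ m
  isLRMin-φ m 1≤m m≤n with true-or-false (isLRMin σ m)
  ... | inj₁ Lm = trans (isLRMin-complete (φ σ) below) (sym Lm)
    where
    below : ∀ y → 1 ≤ y → y < m → at (φ σ) m < at (φ σ) y
    below y 1≤y y<m = let 1≤ρy , ρy<m = reflect-below Lm m≤n 1≤y y<m in
      subst₂ _<_ (sym (φ-at-lrMin Lm 1≤m m≤n)) (sym (at-φ σ y 1≤y (≤-trans (<⇒≤ y<m) m≤n)))
        (isLRMin-sound σ Lm (ρ y) 1≤ρy ρy<m)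
  ... | inj₂ ¬Lm with blockOf m 1≤m m≤n ¬Lm
  ...   | B , s<m , m<e = trans (isLRMin-false (φ σ) (Block.1≤s B) s<m σ′s<σ′m) (sym ¬Lm)
    where
    σ′s<σ′m : at (φ σ) (lastAtMost (isLRMin σ) m) < at (φ σ) m
    σ′s<σ′m = let s<ρm , ρm<e = reflect-inBlock B s<m m<e in
      subst₂ _<_ (sym (φ-at-lrMin (Block.L-s B) (Block.1≤s B) (≤-trans (<⇒≤ s<m) m≤n))) (sym (at-φ σ m 1≤m m≤n))
        (blockStart-below B s<ρm ρm<e)

  lrReflect-φ : ∀ m → 1 ≤ m → m ≤ n → lrReflect (φ σ) m ≡ ρ m
  lrReflect-φ m 1≤m m≤n = trans (cong (λ k → reflect (isLRMin (φ σ)) k m) (length-φ σ))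
    (reflect-cong (isLRMin (φ σ)) (isLRMin σ) n m (λ x 1≤x x≤n → isLRMin-φ x 1≤x x≤n) 1≤m m≤n)

  φ-involutive : φ (φ σ) ≡ σ
  φ-involutive = at-extensionality (φ (φ σ)) σ (trans (length-φ (φ σ)) (length-φ σ)) at-φφ
    where
    at-φφ : ∀ m → 1 ≤ m → m ≤ length (φ (φ σ)) → at (φ (φ σ)) m ≡ at σ m
    at-φφ m 1≤m m≤ = begin
      at (φ (φ σ)) m           ≡⟨ at-φ (φ σ) m 1≤m (subst (m ≤_) (length-φ (φ σ)) m≤) ⟩
      at (φ σ) (lrReflect (φ σ) m) ≡⟨ cong (at (φ σ)) (lrReflect-φ m 1≤m m≤n) ⟩
      at (φ σ) (ρ m)           ≡⟨ φ-at-reflect m 1≤m m≤n ⟩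
      at σ m                   ∎
      where
      open ≡-Reasoning
      m≤n = subst (m ≤_) (trans (length-φ (φ σ)) (length-φ σ)) m≤

  φ-distinctPositive : DistinctPositive (φ σ)
  φ-distinctPositive = record { positive = positive′ ; injective = injective′ }
    where
    positive′ : ∀ m → 1 ≤ m → m ≤ length (φ σ) → 1 ≤ at (φ σ) m
    positive′ m 1≤m m≤ with subst (m ≤_) (length-φ σ) m≤
    ... | m≤n rewrite at-φ σ m 1≤m m≤n = let 1≤ρm , ρm≤n = reflect-range m 1≤m m≤n in positive (ρ m) 1≤ρm ρm≤n
    injective′ : AtInjective (φ σ)
    injective′ a b 1≤a a≤ 1≤b b≤ eq with subst (a ≤_) (length-φ σ) a≤ | subst (b ≤_) (length-φ σ) b≤
    ... | a≤n | b≤n rewrite at-φ σ a 1≤a a≤n | at-φ σ b 1≤b b≤n =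
      let 1≤ρa , ρa≤n = reflect-range a 1≤a a≤n ; 1≤ρb , ρb≤n = reflect-range b 1≤b b≤n in begin
      a         ≡⟨ reflect-involutive a 1≤a a≤n ⟨
      ρ (ρ a)   ≡⟨ cong ρ (injective (ρ a) (ρ b) 1≤ρa ρa≤n 1≤ρb ρb≤n eq) ⟩
      ρ (ρ b)   ≡⟨ reflect-involutive b 1≤b b≤n ⟩
      b         ∎
      where open ≡-Reasoning

boxEmpty : List ℕ → ℕ → ℕ → ℕ → ℕ → Bool
boxEmpty π lo hi vlo vhi =
  not (any (λ m → ((lo <ᵇ m) ∧ (m <ᵇ hi)) ∧ ((vlo <ᵇ at π m) ∧ (at π m <ᵇ vhi))) (range1 (length π)))

EmptyBox : List ℕ → ℕ → ℕ → ℕ → ℕ → Set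
EmptyBox π lo hi vlo vhi = ∀ m → 1 ≤ m → m ≤ length π → lo < m → m < hi → vlo < at π m → at π m < vhi → ⊥

boxEmpty-sound : ∀ π lo hi vlo vhi → T (boxEmpty π lo hi vlo vhi) → EmptyBox π lo hi vlo vhi
boxEmpty-sound π lo hi vlo vhi empty m 1≤m m≤n lo<m m<hi vlo<πm πm<vhi = T-not⇒¬T empty
  (any⁺ _ (lose (∈-range1⁺ 1≤m m≤n)
    (from T-∧ (from T-∧ (<⇒<ᵇ lo<m , <⇒<ᵇ m<hi) , from T-∧ (<⇒<ᵇ vlo<πm , <⇒<ᵇ πm<vhi)))))

boxEmpty-complete : ∀ π lo hi vlo vhi → EmptyBox π lo hi vlo vhi → T (boxEmpty π lo hi vlo vhi)
boxEmpty-complete π lo hi vlo vhi empty = ¬T⇒T-not λ t →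
  let m , m∈ , inBox = find (any⁻ _ _ t)
      1≤m , m≤n = ∈-range1⁻ m∈
      pos , val = to T-∧ inBox
      lo<m , m<hi = to T-∧ pos
      vlo<πm , πm<vhi = to T-∧ val
  in empty m 1≤m m≤n (<ᵇ⇒< _ _ lo<m) (<ᵇ⇒< _ _ m<hi) (<ᵇ⇒< _ _ vlo<πm) (<ᵇ⇒< _ _ πm<vhi)

boxes : List (ℕ × ℕ)
boxes = (0 , 0) ∷ (0 , 2) ∷ (2 , 0) ∷ []

p123 p132 : MeshPattern
p123 = mesh (1 ∷ 2 ∷ 3 ∷ []) boxes
p132 = mesh (1 ∷ 3 ∷ 2 ∷ []) boxes

meshBoxes : List ℕ → ℕ → ℕ → ℕ → ℕ → ℕ → Bool
meshBoxes π i j k a b = boxEmpty π 0 i 0 (at π i) ∧ (boxEmpty π 0 i a b ∧ (boxEmpty π j k 0 (at π i) ∧ true))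

-- The rewrites let the insertion sort of the three values compute.
isOccurrence-123 : ∀ π i j k → at π i < at π j → at π j < at π k →
  isOccurrence p123 π (i ∷ j ∷ k ∷ []) ≡
  orderIso (at π i ∷ at π j ∷ at π k ∷ []) (1 ∷ 2 ∷ 3 ∷ []) ∧ meshBoxes π i j k (at π j) (at π k)
isOccurrence-123 π i j k πi<πj πj<πk rewrite <ᵇ≡true πj<πk | <ᵇ≡true πi<πj = refl

isOccurrence-132 : ∀ π i j k → at π i < at π k → at π k < at π j →
  isOccurrence p132 π (i ∷ j ∷ k ∷ []) ≡
  orderIso (at π i ∷ at π j ∷ at π k ∷ []) (1 ∷ 3 ∷ 2 ∷ []) ∧ meshBoxes π i j k (at π k) (at π j)
isOccurrence-132 π i j k πi<πk πk<πj rewrite <ᵇ≡false (<-asym πk<πj) | <ᵇ≡true πi<πk = refl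

orderIso-123⁻ : ∀ x y z → T (orderIso (x ∷ y ∷ z ∷ []) (1 ∷ 2 ∷ 3 ∷ [])) → x < y × y < z
orderIso-123⁻ x y z h rewrite <ᵇ≡false (n≮n x) | <ᵇ≡false (n≮n y) | <ᵇ≡false (n≮n z) with x <ᵇ y in x<y
... | false = ⊥-elim h
... | true with x <ᵇ z
...   | false = ⊥-elim h
...   | true with y <ᵇ x
...     | true = ⊥-elim h
...     | false with y <ᵇ z in y<z
...       | false = ⊥-elim h
...       | true = <ᵇ⇒< x y (from T-≡ x<y) , <ᵇ⇒< y z (from T-≡ y<z)

orderIso-132⁻ : ∀ x y z → T (orderIso (x ∷ y ∷ z ∷ []) (1 ∷ 3 ∷ 2 ∷ [])) → x < z × z < y
orderIso-132⁻ x y z h rewrite <ᵇ≡false (n≮n x) | <ᵇ≡false (n≮n y) | <ᵇ≡false (n≮n z) with x <ᵇ y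
... | false = ⊥-elim h
... | true with x <ᵇ z in x<z
...   | false = ⊥-elim h
...   | true with y <ᵇ x
...     | true = ⊥-elim h
...     | false with y <ᵇ z
...       | true = ⊥-elim h
...       | false with z <ᵇ x
...         | true = ⊥-elim h
...         | false with z <ᵇ y in z<y
...           | false = ⊥-elim h
...           | true = <ᵇ⇒< x z (from T-≡ x<z) , <ᵇ⇒< z y (from T-≡ z<y)

orderIso-123⁺ : ∀ x y z → x < y → y < z → T (orderIso (x ∷ y ∷ z ∷ []) (1 ∷ 2 ∷ 3 ∷ []))
orderIso-123⁺ x y z x<y y<z
  rewrite <ᵇ≡false (n≮n x) | <ᵇ≡false (n≮n y) | <ᵇ≡false (n≮n z)
        | <ᵇ≡true x<y | <ᵇ≡true y<z | <ᵇ≡true (<-trans x<y y<z)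
        | <ᵇ≡false (<-asym x<y) | <ᵇ≡false (<-asym y<z) | <ᵇ≡false (<-asym (<-trans x<y y<z)) = _

orderIso-132⁺ : ∀ x y z → x < z → z < y → T (orderIso (x ∷ y ∷ z ∷ []) (1 ∷ 3 ∷ 2 ∷ []))
orderIso-132⁺ x y z x<z z<y
  rewrite <ᵇ≡false (n≮n x) | <ᵇ≡false (n≮n y) | <ᵇ≡false (n≮n z)
        | <ᵇ≡true x<z | <ᵇ≡true z<y | <ᵇ≡true (<-trans x<z z<y)
        | <ᵇ≡false (<-asym x<z) | <ᵇ≡false (<-asym z<y) | <ᵇ≡false (<-asym (<-trans x<z z<y)) = _

meshBoxes⁻ : ∀ π i j k a b → T (meshBoxes π i j k a b) →
  EmptyBox π 0 i 0 (at π i) × EmptyBox π 0 i a b × EmptyBox π j k 0 (at π i)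
meshBoxes⁻ π i j k a b h =
  let b₀₀ , rest = to T-∧ h ; b₀₂ , rest′ = to T-∧ rest ; b₂₀ , _ = to T-∧ rest′ in
  boxEmpty-sound π 0 i 0 (at π i) b₀₀ , boxEmpty-sound π 0 i a b b₀₂ , boxEmpty-sound π j k 0 (at π i) b₂₀

meshBoxes⁺ : ∀ π i j k a b →
  EmptyBox π 0 i 0 (at π i) → EmptyBox π 0 i a b → EmptyBox π j k 0 (at π i) → T (meshBoxes π i j k a b)
meshBoxes⁺ π i j k a b b₀₀ b₀₂ b₂₀ = from T-∧ (boxEmpty-complete π 0 i 0 (at π i) b₀₀ ,
  from T-∧ (boxEmpty-complete π 0 i a b b₀₂ , from T-∧ (boxEmpty-complete π j k 0 (at π i) b₂₀ , _)))

Between : ℕ → ℕ → ℕ → Set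
Between a x b = (a < x × x < b) ⊎ (b < x × x < a)

Between-cong : ∀ {a a′ x x′ b b′} → a ≡ a′ → x ≡ x′ → b ≡ b′ → Between a x b → Between a′ x′ b′
Between-cong refl refl refl = id

Between-sym : ∀ {a x b} → Between a x b → Between b x a
Between-sym (inj₁ a<x<b) = inj₂ a<x<b
Between-sym (inj₂ b<x<a) = inj₁ b<x<a

-- Boxes (0,0), (0,2) and (2,0) of R become the fields i-lrMin, ¬between and above.
record UnorderedOccurrence (π : List ℕ) (i j k : ℕ) : Set where
  field
    1≤i      : 1 ≤ i
    i<j      : i < j
    j<k      : j < k
    k≤n      : k ≤ length π
    i-lrMin  : ∀ m → 1 ≤ m → m < i → at π i < at π m
    πi<πj    : at π i < at π j
    πi<πk    : at π i < at π k
    ¬between : ∀ m → 1 ≤ m → m < i → ¬ Between (at π j) (at π m) (at π k)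
    above    : ∀ m → j < m → m < k → at π i < at π m

  1≤j : 1 ≤ j
  1≤j = ≤-trans 1≤i (<⇒≤ i<j)

  1≤k : 1 ≤ k
  1≤k = ≤-trans 1≤j (<⇒≤ j<k)

  j≤n : j ≤ length π
  j≤n = ≤-trans (<⇒≤ j<k) k≤n

  i≤n : i ≤ length π
  i≤n = ≤-trans (<⇒≤ i<j) j≤n

  ∈-Triples : (i ∷ j ∷ k ∷ []) ∈ Triples (length π)
  ∈-Triples = ∈-Triples⁺ (length π) 1≤i i<j j<k k≤n

module _ {π} (D : DistinctPositive π) where
  open DistinctPositive D

  ¬below⇒above : ∀ a m → 1 ≤ a → a ≤ length π → 1 ≤ m → m ≤ length π → a ≢ m →
    ¬ (0 < at π m × at π m < at π a) → at π a < at π m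
  ¬below⇒above a m 1≤a a≤n 1≤m m≤n a≢m ¬below with <-cmp (at π a) (at π m)
  ... | tri< πa<πm _ _ = πa<πm
  ... | tri≈ _ πa≡πm _ = ⊥-elim (a≢m (injective a m 1≤a a≤n 1≤m m≤n πa≡πm))
  ... | tri> _ _ πm<πa = ⊥-elim (¬below (positive m 1≤m m≤n , πm<πa))

  unorderedOccurrence : ∀ {i j k} → 1 ≤ i → i < j → j < k → k ≤ length π →
    at π i < at π j → at π i < at π k →
    EmptyBox π 0 i 0 (at π i) → (∀ m → 1 ≤ m → m < i → ¬ Between (at π j) (at π m) (at π k)) →
    EmptyBox π j k 0 (at π i) → UnorderedOccurrence π i j k
  unorderedOccurrence {i} {j} {k} 1≤i i<j j<k k≤n πi<πj πi<πk b₀₀ ¬between b₂₀ = record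
    { 1≤i = 1≤i ; i<j = i<j ; j<k = j<k ; k≤n = k≤n
    ; i-lrMin = λ m 1≤m m<i → ¬below⇒above i m 1≤i i≤n 1≤m (≤-trans (<⇒≤ m<i) i≤n) (≢-sym (<⇒≢ m<i))
        (λ (0<πm , πm<πi) → b₀₀ m 1≤m (≤-trans (<⇒≤ m<i) i≤n) 1≤m m<i 0<πm πm<πi)
    ; πi<πj = πi<πj ; πi<πk = πi<πk
    ; ¬between = ¬between
    ; above = λ m j<m m<k → let 1≤m = ≤-trans 1≤i (<⇒≤ (<-trans i<j j<m)) ; m≤n = ≤-trans (<⇒≤ m<k) k≤n in
        ¬below⇒above i m 1≤i i≤n 1≤m m≤n (<⇒≢ (<-trans i<j j<m))
          (λ (0<πm , πm<πi) → b₂₀ m 1≤m m≤n j<m m<k 0<πm πm<πi) }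
    where
    i≤n = ≤-trans (<⇒≤ (<-trans i<j j<k)) k≤n

emptyBox⇒¬Between : ∀ π {i a b} → a < b → EmptyBox π 0 i a b → i ≤ length π →
  ∀ m → 1 ≤ m → m < i → ¬ Between a (at π m) b
emptyBox⇒¬Between π a<b empty i≤n m 1≤m m<i (inj₁ (a<πm , πm<b)) = empty m 1≤m (≤-trans (<⇒≤ m<i) i≤n) 1≤m m<i a<πm πm<b
emptyBox⇒¬Between π a<b empty i≤n m 1≤m m<i (inj₂ (b<πm , πm<a)) = <-asym a<b (<-trans b<πm πm<a)

¬Between⇒emptyBox : ∀ {π i a b} → (∀ m → 1 ≤ m → m < i → ¬ Between a (at π m) b) → EmptyBox π 0 i a b
¬Between⇒emptyBox ¬between m 1≤m _ _ m<i a<πm πm<b = ¬between m 1≤m m<i (inj₁ (a<πm , πm<b))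

module _ {π} (D : DistinctPositive π) {i j k} (1≤i : 1 ≤ i) (i<j : i < j) (j<k : j < k) (k≤n : k ≤ length π) where
  private
    i≤n = ≤-trans (<⇒≤ (<-trans i<j j<k)) k≤n
    values : List ℕ
    values = at π i ∷ at π j ∷ at π k ∷ []

  occurrence-123⁻ : T (isOccurrence p123 π (i ∷ j ∷ k ∷ [])) → UnorderedOccurrence π i j k × at π j < at π k
  occurrence-123⁻ h =
    let πi<πj , πj<πk = orderIso-123⁻ _ _ _ (proj₁ (to T-∧ h))
        b₀₀ , b₀₂ , b₂₀ = meshBoxes⁻ π i j k (at π j) (at π k)
                            (proj₂ (to (T-∧ {orderIso values (1 ∷ 2 ∷ 3 ∷ [])}) (subst T (isOccurrence-123 π i j k πi<πj πj<πk) h)))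
    in unorderedOccurrence D 1≤i i<j j<k k≤n πi<πj (<-trans πi<πj πj<πk) b₀₀
         (emptyBox⇒¬Between π πj<πk b₀₂ i≤n) b₂₀ , πj<πk

  occurrence-132⁻ : T (isOccurrence p132 π (i ∷ j ∷ k ∷ [])) → UnorderedOccurrence π i j k × at π k < at π j
  occurrence-132⁻ h =
    let πi<πk , πk<πj = orderIso-132⁻ _ _ _ (proj₁ (to T-∧ h))
        b₀₀ , b₀₂ , b₂₀ = meshBoxes⁻ π i j k (at π k) (at π j)
                            (proj₂ (to (T-∧ {orderIso values (1 ∷ 3 ∷ 2 ∷ [])}) (subst T (isOccurrence-132 π i j k πi<πk πk<πj) h)))
    in unorderedOccurrence D 1≤i i<j j<k k≤n (<-trans πi<πk πk<πj) πi<πk b₀₀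
         (λ m 1≤m m<i → emptyBox⇒¬Between π πk<πj b₀₂ i≤n m 1≤m m<i ∘ Between-sym) b₂₀ , πk<πj

module _ {π i j k} (O : UnorderedOccurrence π i j k) where
  open UnorderedOccurrence O

  private
    lrMin-box : EmptyBox π 0 i 0 (at π i)
    lrMin-box m 1≤m _ _ m<i _ πm<πi = <-asym πm<πi (i-lrMin m 1≤m m<i)

    above-box : EmptyBox π j k 0 (at π i)
    above-box m _ _ j<m m<k _ πm<πi = <-asym πm<πi (above m j<m m<k)

  occurrence-123⁺ : at π j < at π k → T (isOccurrence p123 π (i ∷ j ∷ k ∷ []))
  occurrence-123⁺ πj<πk = subst T (sym (isOccurrence-123 π i j k πi<πj πj<πk))
    (from T-∧ (orderIso-123⁺ _ _ _ πi<πj πj<πk ,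
               meshBoxes⁺ π i j k (at π j) (at π k) lrMin-box (¬Between⇒emptyBox {π} ¬between) above-box))

  occurrence-132⁺ : at π k < at π j → T (isOccurrence p132 π (i ∷ j ∷ k ∷ []))
  occurrence-132⁺ πk<πj = subst T (sym (isOccurrence-132 π i j k πi<πk πk<πj))
    (from T-∧ (orderIso-132⁺ _ _ _ πi<πk πk<πj ,
               meshBoxes⁺ π i j k (at π k) (at π j) lrMin-box (¬Between⇒emptyBox {π} (λ m 1≤m m<i → ¬between m 1≤m m<i ∘ Between-sym)) above-box))

-- φ exchanges the two patterns

reflectTriple : List ℕ → List ℕ → List ℕ
reflectTriple σ (i ∷ j ∷ k ∷ []) = i ∷ lrReflect σ k ∷ lrReflect σ j ∷ []
reflectTriple σ t                = t

occurrenceTriples : MeshPattern → List ℕ → List (List ℕ)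
occurrenceTriples p π = filter (T? ∘ isOccurrence p π) (Triples (length π))

module Occurrences (σ : List ℕ) (D : DistinctPositive σ) where
  open Involution σ D

  module _ {i j k} (O : UnorderedOccurrence σ i j k) where
    open UnorderedOccurrence O
    private
      Li : isLRMin σ i ≡ true
      Li = isLRMin-complete σ i-lrMin
      ¬Lj : isLRMin σ j ≡ false
      ¬Lj = isLRMin-false σ 1≤i i<j πi<πj

    occurrence-inBlock : ∃[ s ] ∃[ e ] (Block s e × i ≤ s × s < j × k < e)
    occurrence-inBlock with blockOf j 1≤j j≤n ¬Lj
    ... | B , s<j , j<e = _ , _ , B , i≤s , s<j , k<e
      where
      i≤s : i ≤ lastAtMost (isLRMin σ) j
      i≤s = ≮⇒≥ (λ s<i → ≡true⇒≢false Li (Block.¬L-in B i s<i (<-trans i<j j<e)))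
      -- a block end e ≤ k would be a left-to-right minimum lying above σ i
      k<e : k < blockEnd (isLRMin σ) n j
      k<e = ≰⇒> λ e≤k → case m≤n⇒m<n∨m≡n e≤k of λ
        { (inj₂ refl) → ≡true⇒≢false (Block.L-e B k≤n) (isLRMin-false σ 1≤i (<-trans i<j j<k) πi<πk)
        ; (inj₁ e<k)  → ≡true⇒≢false (Block.L-e B (≤-trans (<⇒≤ e<k) k≤n))
                          (isLRMin-false σ 1≤i (<-trans i<j j<e) (above _ j<e e<k)) }

    reflect-occurrence : UnorderedOccurrence (φ σ) i (ρ k) (ρ j)
    reflect-occurrence with occurrence-inBlock
    ... | s , e , B , i≤s , s<j , k<e = record
      { 1≤i      = 1≤i
      ; i<j      = ≤-<-trans i≤s s<ρk
      ; j<k      = reflect-antitone B s<j j<k k<e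
      ; k≤n      = subst (ρ j ≤_) (sym (length-φ σ)) (proj₂ (reflect-range j 1≤j j≤n))
      ; i-lrMin  = λ m 1≤m m<i → let 1≤ρm , ρm<i = reflect-below Li i≤n 1≤m m<i in
                     subst₂ _<_ (sym φi) (sym (φm 1≤m (≤-trans (<⇒≤ m<i) i≤n))) (i-lrMin (ρ m) 1≤ρm ρm<i)
      ; πi<πj    = subst₂ _<_ (sym φi) (sym φk) πi<πk
      ; πi<πk    = subst₂ _<_ (sym φi) (sym φj) πi<πj
      ; ¬between = λ m 1≤m m<i → let 1≤ρm , ρm<i = reflect-below Li i≤n 1≤m m<i in
                     ¬between (ρ m) 1≤ρm ρm<i ∘ Between-sym ∘ Between-cong φk (φm 1≤m (≤-trans (<⇒≤ m<i) i≤n)) φj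
      ; above    = λ m ρk<m m<ρj → subst₂ _<_ (sym φi) (sym (φm (1≤m ρk<m) (m≤n m<ρj)))
                     (above (ρ m) (j<ρm ρk<m m<ρj) (ρm<k ρk<m m<ρj))
      }
      where
      s<k : s < k
      s<k = <-trans s<j j<k
      s<ρk : s < ρ k
      s<ρk = proj₁ (reflect-inBlock B s<k k<e)
      ρj<e : ρ j < e
      ρj<e = proj₂ (reflect-inBlock B s<j (<-trans j<k k<e))
      φi : at (φ σ) i ≡ at σ i
      φi = φ-at-lrMin Li 1≤i i≤n
      φj : at (φ σ) (ρ j) ≡ at σ j
      φj = φ-at-reflect j 1≤j j≤n
      φk : at (φ σ) (ρ k) ≡ at σ k
      φk = φ-at-reflect k 1≤k k≤n
      φm : ∀ {m} → 1 ≤ m → m ≤ n → at (φ σ) m ≡ at σ (ρ m)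
      φm = at-φ σ _
      s<m : ∀ {m} → ρ k < m → s < m
      s<m ρk<m = <-trans s<ρk ρk<m
      m<e : ∀ {m} → m < ρ j → m < e
      m<e m<ρj = <-trans m<ρj ρj<e
      1≤m : ∀ {m} → ρ k < m → 1 ≤ m
      1≤m ρk<m = ≤-trans (Block.1≤s B) (<⇒≤ (s<m ρk<m))
      m≤n : ∀ {m} → m < ρ j → m ≤ n
      m≤n m<ρj = m<1+n⇒m≤n (<-≤-trans (m<e m<ρj) (Block.e≤1+n B))
      j<ρm : ∀ {m} → ρ k < m → m < ρ j → j < ρ m
      j<ρm {m} ρk<m m<ρj = subst (_< ρ m) (reflect-involutive j 1≤j j≤n) (reflect-antitone B (s<m ρk<m) m<ρj ρj<e)
      ρm<k : ∀ {m} → ρ k < m → m < ρ j → ρ m < k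
      ρm<k {m} ρk<m m<ρj = subst (ρ m <_) (reflect-involutive k 1≤k k≤n)
                         (reflect-antitone B s<ρk ρk<m (m<e m<ρj))

  reflectTriple-123→132 : ∀ {t} → t ∈ occurrenceTriples p123 σ → reflectTriple σ t ∈ occurrenceTriples p132 (φ σ)
  reflectTriple-123→132 t∈ with ∈-filter⁻ (T? ∘ isOccurrence p123 σ) t∈
  ... | t∈₃ , occ with ∈-Triples⁻ n t∈₃
  ...   | i , j , k , refl , 1≤i , i<j , j<k , k≤n with occurrence-123⁻ D 1≤i i<j j<k k≤n occ
  ...     | O , πj<πk = ∈-filter⁺ (T? ∘ isOccurrence p132 (φ σ)) (UnorderedOccurrence.∈-Triples O′)
    (occurrence-132⁺ O′ (subst₂ _<_ (sym (φ-at-reflect j 1≤j j≤n)) (sym (φ-at-reflect k 1≤k k≤n)) πj<πk))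
    where
    open UnorderedOccurrence O using (1≤j; 1≤k; j≤n)
    O′ : UnorderedOccurrence (φ σ) i (ρ k) (ρ j)
    O′ = reflect-occurrence O

  reflectTriple-132→123 : ∀ {t} → t ∈ occurrenceTriples p132 σ → reflectTriple σ t ∈ occurrenceTriples p123 (φ σ)
  reflectTriple-132→123 t∈ with ∈-filter⁻ (T? ∘ isOccurrence p132 σ) t∈
  ... | t∈₃ , occ with ∈-Triples⁻ n t∈₃
  ...   | i , j , k , refl , 1≤i , i<j , j<k , k≤n with occurrence-132⁻ D 1≤i i<j j<k k≤n occ
  ...     | O , πk<πj = ∈-filter⁺ (T? ∘ isOccurrence p123 (φ σ)) (UnorderedOccurrence.∈-Triples O′)
    (occurrence-123⁺ O′ (subst₂ _<_ (sym (φ-at-reflect k 1≤k k≤n)) (sym (φ-at-reflect j 1≤j j≤n)) πk<πj))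
    where
    open UnorderedOccurrence O using (1≤j; 1≤k; j≤n)
    O′ : UnorderedOccurrence (φ σ) i (ρ k) (ρ j)
    O′ = reflect-occurrence O

  reflectTriple-involutive : ∀ {t} → t ∈ Triples n → reflectTriple σ (reflectTriple σ t) ≡ t
  reflectTriple-involutive t∈ with ∈-Triples⁻ n t∈
  ... | i , j , k , refl , 1≤i , i<j , j<k , k≤n =
    cong₂ (λ j′ k′ → i ∷ j′ ∷ k′ ∷ []) (reflect-involutive j 1≤j j≤n) (reflect-involutive k 1≤k k≤n)
    where
    1≤j : 1 ≤ j
    1≤j = ≤-trans 1≤i (<⇒≤ i<j)
    1≤k : 1 ≤ k
    1≤k = ≤-trans 1≤j (<⇒≤ j<k)
    j≤n : j ≤ n
    j≤n = ≤-trans (<⇒≤ j<k) k≤n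

  reflectTriple-φ : ∀ {t} → t ∈ Triples n → reflectTriple (φ σ) t ≡ reflectTriple σ t
  reflectTriple-φ t∈ with ∈-Triples⁻ n t∈
  ... | i , j , k , refl , 1≤i , i<j , j<k , k≤n =
    cong₂ (λ k′ j′ → i ∷ k′ ∷ j′ ∷ []) (lrReflect-φ k 1≤k k≤n) (lrReflect-φ j 1≤j j≤n)
    where
    1≤j : 1 ≤ j
    1≤j = ≤-trans 1≤i (<⇒≤ i<j)
    1≤k : 1 ≤ k
    1≤k = ≤-trans 1≤j (<⇒≤ j<k)
    j≤n : j ≤ n
    j≤n = ≤-trans (<⇒≤ j<k) k≤n

occurrences132-φ : ∀ σ → DistinctPositive σ → occurrences p132 (φ σ) ≡ occurrences p123 σ
occurrences132-φ σ D = sym (length-≡-inverses (reflectTriple σ) (reflectTriple σ)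
  (occurrenceTriples p123 σ) (occurrenceTriples p132 (φ σ))
  (Unique.filter⁺ _ (Triples-unique (length σ))) (Unique.filter⁺ _ (Triples-unique (length (φ σ))))
  reflectTriple-123→132 back
  (reflectTriple-involutive ∘ proj₁ ∘ ∈-filter⁻ _)
  (reflectTriple-involutive ∘ inTriples))
  where
  open Occurrences σ D
  inTriples : ∀ {t} → t ∈ occurrenceTriples p132 (φ σ) → t ∈ Triples (length σ)
  inTriples = subst (λ m → _ ∈ Triples m) (length-φ σ) ∘ proj₁ ∘ ∈-filter⁻ _
  back : ∀ {t} → t ∈ occurrenceTriples p132 (φ σ) → reflectTriple σ t ∈ occurrenceTriples p123 σ
  back {t} t∈ = subst₂ (λ t′ σ′ → t′ ∈ occurrenceTriples p123 σ′) (reflectTriple-φ (inTriples t∈)) (Involution.φ-involutive σ D)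
    (Occurrences.reflectTriple-132→123 (φ σ) (Involution.φ-distinctPositive σ D) t∈)

occurrences123-φ : ∀ σ → DistinctPositive σ → occurrences p123 (φ σ) ≡ occurrences p132 σ
occurrences123-φ σ D = begin
  occurrences p123 (φ σ)         ≡⟨ occurrences132-φ (φ σ) (Involution.φ-distinctPositive σ D) ⟨
  occurrences p132 (φ (φ σ))     ≡⟨ cong (occurrences p132) (Involution.φ-involutive σ D) ⟩
  occurrences p132 σ             ∎
  where open ≡-Reasoning

∈-perms⇒distinctPositive : ∀ n {π} → π ∈ perms n → DistinctPositive π
∈-perms⇒distinctPositive n {π} π∈ = let _ , entries , injective = ∈-perms⁻ n π∈ in record
  { positive  = λ m 1≤m m≤ → proj₁ (entries (at-∈ π m 1≤m m≤))
  ; injective = injective }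

φ-∈-perms : ∀ n {π} → π ∈ perms n → φ π ∈ perms n
φ-∈-perms n {π} π∈ = ∈-perms⁺ n (φ π) (trans (length-φ π) (proj₁ (∈-perms⁻ n π∈))) entries′
  (DistinctPositive.injective φ-distinctPositive)
  where
  entries : EntriesIn n π
  entries = proj₁ (proj₂ (∈-perms⁻ n π∈))
  open Involution π (∈-perms⇒distinctPositive n π∈) using (ρ; reflect-range; φ-distinctPositive)
  entries′ : EntriesIn n (φ π)
  entries′ x∈ with ∈-map⁻ _ x∈
  ... | m , m∈ , refl = let 1≤m , m≤n = ∈-range1⁻ m∈ ; 1≤ρm , ρm≤n = reflect-range m 1≤m m≤n in
    entries (at-∈ π (ρ m) 1≤ρm ρm≤n)

theorem3p5 : Equidistributed (mesh (1 ∷ 2 ∷ 3 ∷ []) ((0 , 0) ∷ (0 , 2) ∷ (2 , 0) ∷ [])) (mesh (1 ∷ 3 ∷ 2 ∷ []) ((0 , 0) ∷ (0 , 2) ∷ (2 , 0) ∷ []))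
theorem3p5 n ℓ = length-filter-involution _ _ φ (perms n) (perms-unique n) (φ-∈-perms n)
  (λ π∈ → Involution.φ-involutive _ (D π∈))
  (λ π∈ → subst (λ c → T (c ≡ᵇ ℓ)) (sym (occurrences132-φ _ (D π∈))))
  (λ π∈ → subst (λ c → T (c ≡ᵇ ℓ)) (sym (occurrences123-φ _ (D π∈))))
  where
  D : ∀ {π} → π ∈ perms n → DistinctPositive π
  D = ∈-perms⇒distinctPositive n
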